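{- Let $A\subset\mathbb{Z}^d$ be a finite subset. If $A$ is $i$-compressed for some $1\leq i\leq d$, then $C_j(A)$ remains $i$-compressed for any $1\leq j\leq d$.
   Context: Compressions in $\mathbb{Z}^d$ are defined as follows. For $1\leq i\leq d$, identify $\mathbb{Z}^d$ with $\mathbb{Z}^{d-1}\times\mathbb{Z}$ via $\sigma_i(x_1,\dots,x_d)=((x_1,\dots,x_{i-1},x_{i+1},\dots,x_d),x_i)$. For a finite set $A\subset\mathbb{Z}^d$ and $b\in\mathbb{Z}^{d-1}$, let $J_i(A;b)=\{c\in\mathbb{Z}:(b,c)\in A\}$ (with $(b,c)$ understood via $\sigma_i$) and $\ell_i(A;b)=\#J_i(A;b)$. For a positive integer $\ell$, let $I(\ell)\subset\mathbb{Z}$ be the interval of integers centered at the origin with length $\ell$ if $\ell$ is odd, and length $\ell+1$ if $\ell$ is even. The $i$-compression of $A$ is $$C_i(A)=\bigcup_{b\in\mathbb{Z}^{d-1},\ \ell_i(A;b)>0}\{b\}\times I(\ell_i(A;b)),$$ i.e. each line parallel to the $i$-th coordinate axis meeting $A$ is replaced by a centered interval of integers of (essentially) the same size. The set $A$ is called $i$-compressed if $C_i(A)=A$. -}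

module Defs where

open import Data.Nat using (ℕ; suc; _*_; _/_)
open import Data.Integer using (ℤ; +_; _-_) renaming (_≟_ to _≟ℤ_)
open import Data.Fin using (Fin)
open import Data.Vec using (Vec; lookup; removeAt; insertAt)
open import Data.Vec.Properties using (≡-dec)
open import Data.List using (List; map; filter; length; deduplicate; concatMap; upTo)
open import Data.List.Membership.Propositional using (_∈_)
open import Data.Product using (_×_)

-- Points of ℤ^d, d = suc n, are vectors; coordinate index i : Fin (suc n).
-- σ_i(x) = (removeAt x i , lookup x i); its inverse is (b , c) ↦ insertAt b i c.
Point : ℕ → Set
Point d = Vec ℤ d

-- Finite subsets of ℤ^d are represented by lists (duplicates irrelevant;
-- sets are compared extensionally via membership).
FinSet : ℕ → Set
FinSet d = List (Point d)

-- J_i(A;b) = { c : (b,c) ∈ A }  (as a list, possibly with repetitions)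
J : ∀ {n} → Fin (suc n) → FinSet (suc n) → Point n → List ℤ
J i A b = map (λ x → lookup x i)
              (filter (λ x → ≡-dec _≟ℤ_ (removeAt x i) b) A)

ℓ : ∀ {n} → Fin (suc n) → FinSet (suc n) → Point n → ℕ
ℓ i A b = length (deduplicate _≟ℤ_ (J i A b))

-- I(ℓ): centered integer interval of length ℓ (ℓ odd) or ℓ+1 (ℓ even),
-- i.e. { -k, …, k } with k = ⌊ℓ/2⌋.
I : ℕ → List ℤ
I l = map (λ m → + m - + (l / 2)) (upTo (suc (2 * (l / 2))))

-- C_i(A) = ⋃_{b : ℓ_i(A;b) > 0} {b} × I(ℓ_i(A;b)).
-- The lines b with ℓ_i(A;b) > 0 are exactly the b = removeAt a i for a ∈ A.
C : ∀ {n} → Fin (suc n) → FinSet (suc n) → FinSet (suc n)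
C i A = concatMap (λ a → map (λ c → insertAt (removeAt a i) i c)
                                 (I (ℓ i A (removeAt a i)))) A

Compressed : ∀ {n} → Fin (suc n) → FinSet (suc n) → Set
Compressed i A = ∀ x → (x ∈ C i A → x ∈ A) × (x ∈ A → x ∈ C i A)

module Submission where

-- Call B ⊆ ℤ^d *i-down-closed* if along every line parallel to the
-- i-th axis it is closed under moving towards the centre: x ∈ B and y on
-- the i-line of x with |y_i| ≤ |x_i| imply y ∈ B.  Such a line section is
-- then an interval {-k,…,k} with 2k+1 points, so its compression is itself:
-- i-down-closed and i-compressed are the same property.  By construction
-- C_i(A) is i-down-closed, which settles the case j = i.  For j ≠ i, take
-- x ∈ C_j(A) and y on its i-line with |y_i| ≤ |x_i|.  Moving every point z
-- of A on the j-line of x to height y_i in direction i stays inside A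
-- (A is i-down-closed and z_i = x_i) and lands on the j-line of y, so that
-- line of A carries at least as many points; since y_j = x_j, y ∈ C_j(A).

open import Defs
open import Data.Nat using (ℕ; zero; suc; _+_; _*_; _∸_; _/_; _≤_; _<_; z≤n; s≤s; s≤s⁻¹)
import Data.Nat.Properties as ℕP
open import Data.Nat.DivMod using (/-monoˡ-≤; m*n/n≡m; +-distrib-/; m*n%n≡0)
open import Data.Integer as ℤ using (ℤ; +_; -[1+_]; _⊖_; ∣_∣) renaming (_≟_ to _≟ℤ_)
import Data.Integer.Properties as ℤP
open import Algebra.Bundles using (AbelianGroup)
open import Algebra.Properties.Group (AbelianGroup.group ℤP.+-0-abelianGroup) using (∙-cancelʳ)
open import Data.Fin using (Fin; punchIn; punchOut) renaming (_≟_ to _≟F_)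
open import Data.Fin.Properties using (punchInᵢ≢i; punchOut-punchIn)
open import Data.Vec using (Vec; lookup; removeAt; insertAt; tabulate; _[_]≔_)
open import Data.Vec.Properties
  using (≡-dec; removeAt-insertAt; insertAt-lookup; insertAt-removeAt; removeAt-punchOut;
         tabulate∘lookup; tabulate-cong; lookup∘update; lookup∘update′)
open import Data.List using (List; []; _∷_; _++_; map; filter; length; deduplicate; upTo)
open import Data.List.Properties using (length-map; length-upTo; length-++-sucʳ)
open import Data.List.Membership.Propositional using (_∈_; find; lose)
open import Data.List.Membership.Propositional.Properties
  using (∈-map⁺; ∈-map⁻; ∈-filter⁺; ∈-filter⁻; ∈-concatMap⁺; ∈-concatMap⁻;
         ∈-deduplicate⁺; ∈-deduplicate⁻; ∈-upTo⁺; ∈-upTo⁻; ∈-∃++; ∈-++⁻; ∈-++⁺ˡ; ∈-++⁺ʳ)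
open import Data.List.Relation.Binary.Subset.Propositional using (_⊆_)
open import Data.List.Relation.Unary.Any using (here; there; any?)
open import Data.List.Relation.Unary.All as All using ()
open import Data.List.Relation.Unary.AllPairs using (_∷_)
open import Data.List.Relation.Unary.Unique.Propositional using (Unique)
import Data.List.Relation.Unary.Unique.Propositional.Properties as Unique
open import Data.List.Relation.Unary.Unique.DecPropositional.Properties _≟ℤ_ using (deduplicate-!)
open import Data.Product using (∃; _×_; _,_; proj₁; proj₂)
open import Data.Sum using (inj₁; inj₂)
open import Data.Empty using (⊥-elim)
open import Function using (_∘_)
open import Relation.Nullary using (yes; no; contradiction)
open import Relation.Binary.PropositionalEquality
  using (_≡_; _≢_; refl; sym; trans; cong; subst; subst₂; module ≡-Reasoning)

length-≤-⊆ : ∀ {A : Set} {xs ys : List A} → Unique xs → xs ⊆ ys → length xs ≤ length ys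
length-≤-⊆ {xs = []} _ _ = z≤n
length-≤-⊆ {xs = x ∷ xs} (x∉xs ∷ unique) xs⊆ys with ∈-∃++ (xs⊆ys (here refl))
... | us , vs , refl = begin
    suc (length xs)          ≤⟨ s≤s (length-≤-⊆ unique xs⊆us++vs) ⟩
    suc (length (us ++ vs))  ≡⟨ sym (length-++-sucʳ us x vs) ⟩
    length (us ++ x ∷ vs)    ∎
  where
  open ℕP.≤-Reasoning
  -- the tail of a duplicate-free list avoids its head
  xs⊆us++vs : xs ⊆ us ++ vs
  xs⊆us++vs z∈xs with ∈-++⁻ us (xs⊆ys (there z∈xs))
  ... | inj₁ z∈us         = ∈-++⁺ˡ z∈us
  ... | inj₂ (here refl)  = ⊥-elim (All.lookup x∉xs z∈xs refl)
  ... | inj₂ (there z∈vs) = ∈-++⁺ʳ us z∈vs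

#distinct : List ℤ → ℕ
#distinct L = length (deduplicate _≟ℤ_ L)

#distinct-mono : ∀ {L L′ : List ℤ} → L ⊆ L′ → #distinct L ≤ #distinct L′
#distinct-mono {L} L⊆L′ =
  length-≤-⊆ (deduplicate-! L) (∈-deduplicate⁺ _≟ℤ_ ∘ L⊆L′ ∘ ∈-deduplicate⁻ _≟ℤ_ L)

interval : ℕ → List ℤ
interval k = map (λ m → + m ℤ.- + k) (upTo (suc (2 * k)))

length-interval : ∀ k → length (interval k) ≡ suc (2 * k)
length-interval k = trans (length-map _ (upTo (suc (2 * k)))) (length-upTo _)

interval-unique : ∀ k → Unique (interval k)
interval-unique k = Unique.map⁺ (ℤP.+-injective ∘ ∙-cancelʳ (ℤ.- + k) _ _) (Unique.upTo⁺ _)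

∈-interval⁻ : ∀ {k c} → c ∈ interval k → ∣ c ∣ ≤ k
∈-interval⁻ {k} c∈ with ∈-map⁻ _ c∈
... | m , m∈ , refl rewrite ℤP.m-n≡m⊖n m k with ℕP.≤-total m k
... | inj₁ m≤k = subst (_≤ k) (sym (ℤP.∣⊖∣-≤ m≤k)) (ℕP.m∸n≤m k m)
... | inj₂ k≤m = subst (_≤ k) (sym (cong ∣_∣ (ℤP.⊖-≥ k≤m)))
                   (ℕP.m≤n+o⇒m∸n≤o m k (subst (m ≤_) (cong (λ v → k + v) (ℕP.+-identityʳ k))
                     (s≤s⁻¹ (∈-upTo⁻ m∈))))

∈-interval⁺ : ∀ {k c} → ∣ c ∣ ≤ k → c ∈ interval k
∈-interval⁺ {k} {+ n} n≤k = subst (_∈ interval k) centred (∈-map⁺ _ (∈-upTo⁺ (s≤s bound)))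
  where
  centred : + (n + k) ℤ.- + k ≡ + n
  centred = trans (ℤP.m-n≡m⊖n (n + k) k)
                  (trans (ℤP.⊖-≥ (ℕP.m≤n+m k n)) (cong +_ (ℕP.m+n∸n≡m n k)))
  bound : n + k ≤ 2 * k
  bound = subst (n + k ≤_) (cong (λ v → k + v) (sym (ℕP.+-identityʳ k))) (ℕP.+-monoˡ-≤ k n≤k)
∈-interval⁺ {k} { -[1+ n ]} n<k = subst (_∈ interval k) centred (∈-map⁺ _ (∈-upTo⁺ (s≤s bound)))
  where
  centred : + (k ∸ suc n) ℤ.- + k ≡ -[1+ n ]
  centred = trans (ℤP.m-n≡m⊖n (k ∸ suc n) k)
                  (trans (ℤP.⊖-< (ℕP.∸-monoʳ-< {k} {suc n} {0} (s≤s z≤n) n<k))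
                         (cong (ℤ.-_ ∘ +_) (ℕP.m∸[m∸n]≡n n<k)))
  bound : k ∸ suc n ≤ 2 * k
  bound = ℕP.≤-trans (ℕP.m∸n≤m k (suc n)) (ℕP.m≤m+n k _)

half-odd : ∀ k → suc (2 * k) / 2 ≡ k
half-odd k = begin
    suc (2 * k) / 2  ≡⟨ cong (λ v → suc v / 2) (ℕP.*-comm 2 k) ⟩
    (1 + k * 2) / 2  ≡⟨ +-distrib-/ 1 (k * 2) (subst (λ r → 1 + r < 2) (sym (m*n%n≡0 k 2)) ℕP.≤-refl) ⟩
    0 + k * 2 / 2    ≡⟨ m*n/n≡m k 2 ⟩
    k                ∎
  where open ≡-Reasoning

≤radius : ∀ {L k} → (∀ {t} → ∣ t ∣ ≤ k → t ∈ L) → k ≤ #distinct L / 2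
≤radius {L} {k} covers = subst (_≤ #distinct L / 2) (half-odd k) (/-monoˡ-≤ 2 many)
  where
  many : suc (2 * k) ≤ #distinct L
  many = subst (_≤ #distinct L) (length-interval k)
           (length-≤-⊆ (interval-unique k) (∈-deduplicate⁺ _≟ℤ_ ∘ covers ∘ ∈-interval⁻))

radius< : ∀ {L r t₀} → t₀ ∈ L → (∀ {t} → t ∈ L → ∣ t ∣ < r) → #distinct L / 2 < r
radius< {r = zero} t₀∈ below with below t₀∈
... | ()
radius< {L} {suc k} _ below = s≤s (subst (#distinct L / 2 ≤_) (half-odd k) (/-monoˡ-≤ 2 few))
  where
  few : #distinct L ≤ suc (2 * k)
  few = subst (#distinct L ≤_) (length-interval k)
          (length-≤-⊆ (deduplicate-! L)
            (∈-interval⁺ ∘ s≤s⁻¹ ∘ below ∘ ∈-deduplicate⁻ _≟ℤ_ L))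

module _ {A : Set} {m : ℕ} where

  sameLine⇒lookup : (x y : Vec A (suc m)) {i k : Fin (suc m)} →
                    removeAt x i ≡ removeAt y i → i ≢ k → lookup x k ≡ lookup y k
  sameLine⇒lookup x y {i} {k} e i≢k = begin
      lookup x k                           ≡⟨ sym (removeAt-punchOut x i≢k) ⟩
      lookup (removeAt x i) (punchOut i≢k) ≡⟨ cong (λ v → lookup v (punchOut i≢k)) e ⟩
      lookup (removeAt y i) (punchOut i≢k) ≡⟨ removeAt-punchOut y i≢k ⟩
      lookup y k                           ∎
    where open ≡-Reasoning

  lookup⇒sameLine : (x y : Vec A (suc m)) (i : Fin (suc m)) →
                    (∀ k → i ≢ k → lookup x k ≡ lookup y k) → removeAt x i ≡ removeAt y i
  lookup⇒sameLine x y i agree = begin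
      removeAt x i                                 ≡⟨ sym (tabulate∘lookup (removeAt x i)) ⟩
      tabulate (lookup (removeAt x i))             ≡⟨ tabulate-cong entries ⟩
      tabulate (lookup (removeAt y i))             ≡⟨ tabulate∘lookup (removeAt y i) ⟩
      removeAt y i                                 ∎
    where
    open ≡-Reasoning
    lookup-removeAt : ∀ v k → lookup (removeAt v i) k ≡ lookup v (punchIn i k)
    lookup-removeAt v k =
      trans (cong (lookup (removeAt v i)) (sym (punchOut-punchIn i)))
            (removeAt-punchOut v (punchInᵢ≢i i k ∘ sym))
    entries : ∀ k → lookup (removeAt x i) k ≡ lookup (removeAt y i) k
    entries k = trans (lookup-removeAt x k)
                  (trans (agree (punchIn i k) (punchInᵢ≢i i k ∘ sym)) (sym (lookup-removeAt y k)))

  removeAt-[]≔ : (x : Vec A (suc m)) (i : Fin (suc m)) (c : A) → removeAt (x [ i ]≔ c) i ≡ removeAt x i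
  removeAt-[]≔ x i c = lookup⇒sameLine (x [ i ]≔ c) x i (λ k i≢k → lookup∘update′ (i≢k ∘ sym) x c)

module _ {n : ℕ} where

  ∈-J⁻ : ∀ {i : Fin (suc n)} {A : FinSet (suc n)} {b t} → t ∈ J i A b →
         ∃ λ y → y ∈ A × removeAt y i ≡ b × lookup y i ≡ t
  ∈-J⁻ {i} {A} {b} t∈ with ∈-map⁻ _ t∈
  ... | y , y∈ , refl with ∈-filter⁻ (λ x → ≡-dec _≟ℤ_ (removeAt x i) b) {xs = A} y∈
  ... | y∈A , e = y , y∈A , e , refl

  ∈-J⁺ : ∀ {i : Fin (suc n)} {A : FinSet (suc n)} {b y} → y ∈ A → removeAt y i ≡ b →
         lookup y i ∈ J i A b
  ∈-J⁺ {i} {A} {b} y∈A e = ∈-map⁺ _ (∈-filter⁺ (λ x → ≡-dec _≟ℤ_ (removeAt x i) b) y∈A e)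

  ∈-C⁻ : ∀ {i : Fin (suc n)} {A : FinSet (suc n)} {x} → x ∈ C i A →
         (∃ λ t → t ∈ J i A (removeAt x i)) × ∣ lookup x i ∣ ≤ ℓ i A (removeAt x i) / 2
  ∈-C⁻ {i} {A} {x} x∈C with find (∈-concatMap⁻ (λ a → map (λ c → insertAt (removeAt a i) i c)
                                     (I (ℓ i A (removeAt a i)))) {xs = A} x∈C)
  ... | a , a∈A , x∈line with ∈-map⁻ _ x∈line
  ... | c , c∈I , refl
    rewrite insertAt-lookup (removeAt a i) i c | removeAt-insertAt (removeAt a i) i c
    = (lookup a i , ∈-J⁺ a∈A refl) , ∈-interval⁻ c∈I

  ∈-C⁺ : ∀ {i : Fin (suc n)} {A : FinSet (suc n)} {x t} → t ∈ J i A (removeAt x i) →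
         ∣ lookup x i ∣ ≤ ℓ i A (removeAt x i) / 2 → x ∈ C i A
  ∈-C⁺ {i} {A} {x} t∈ bound with ∈-J⁻ {i} {A} t∈
  ... | a , a∈A , e , _ =
    ∈-concatMap⁺ (λ a → map (λ c → insertAt (removeAt a i) i c) (I (ℓ i A (removeAt a i))))
      (lose a∈A (subst (λ b → x ∈ map (λ c → insertAt b i c) (I (ℓ i A b))) (sym e) x∈line))
    where
    x∈line : x ∈ map (λ c → insertAt (removeAt x i) i c) (I (ℓ i A (removeAt x i)))
    x∈line = subst (_∈ map (λ c → insertAt (removeAt x i) i c) (I (ℓ i A (removeAt x i))))
                   (insertAt-removeAt x i) (∈-map⁺ _ (∈-interval⁺ bound))

  DownClosed : Fin (suc n) → FinSet (suc n) → Set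
  DownClosed i B = ∀ {x y} → x ∈ B → removeAt x i ≡ removeAt y i →
                   ∣ lookup y i ∣ ≤ ∣ lookup x i ∣ → y ∈ B

  -- A down-closed line section is a centred interval, hence its own compression.
  downClosed⇒compressed : ∀ {i B} → DownClosed i B → Compressed i B
  downClosed⇒compressed {i} {B} closed x = C⊆B , B⊆C
    where
    C⊆B : x ∈ C i B → x ∈ B
    C⊆B x∈C with ∈-C⁻ {i} {B} x∈C | any? (≡-dec _≟ℤ_ x) B
    ... | _ | yes x∈B = x∈B
    ... | (_ , t₀∈) , bound | no x∉B = contradiction bound (ℕP.<⇒≱ (radius< t₀∈ below))
      where
      below : ∀ {t} → t ∈ J i B (removeAt x i) → ∣ t ∣ < ∣ lookup x i ∣
      below t∈ with ∈-J⁻ {i} {B} t∈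
      ... | y , y∈B , e , refl = ℕP.≰⇒> (x∉B ∘ closed y∈B e)
    B⊆C : x ∈ B → x ∈ C i B
    B⊆C x∈B = ∈-C⁺ {i} {B} (∈-J⁺ x∈B refl) (≤radius filled)
      where
      -- every height t with |t| ≤ |x_i| occurs on the line, at x [ i ]≔ t
      filled : ∀ {t} → ∣ t ∣ ≤ ∣ lookup x i ∣ → t ∈ J i B (removeAt x i)
      filled {t} t≤x = subst (_∈ J i B (removeAt x i)) (lookup∘update i x t)
        (∈-J⁺ (closed {y = x [ i ]≔ t} x∈B (sym (removeAt-[]≔ x i t))
                 (subst (λ v → ∣ v ∣ ≤ ∣ lookup x i ∣) (sym (lookup∘update i x t)) t≤x))
              (removeAt-[]≔ x i t))

  -- C_i(A) is i-down-closed, since membership only bounds |x_i| on each line.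
  C-downClosed : ∀ {i A} → DownClosed i (C i A)
  C-downClosed {i} {A} {x} {y} x∈C e y≤x with ∈-C⁻ {i} {A} x∈C
  ... | (t , t∈) , bound =
    ∈-C⁺ {i} {A} (subst (λ b → t ∈ J i A b) e t∈)
         (ℕP.≤-trans y≤x (subst (λ b → ∣ lookup x i ∣ ≤ ℓ i A b / 2) e bound))

  -- Conversely an i-compressed set equals C_i(A), hence is i-down-closed.
  compressed⇒downClosed : ∀ {i A} → Compressed i A → DownClosed i A
  compressed⇒downClosed {i} {A} compressed {x} {y} x∈A e y≤x =
    proj₁ (compressed y) (C-downClosed {i} {A} (proj₂ (compressed x) x∈A) e y≤x)

  -- For i ≢ j, shifting the points of A on the j-line of x to height y_i in
  -- direction i keeps them in A and moves them onto the j-line of y, without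
  -- changing their j-coordinate.
  shift-line : ∀ {i j A x y} → i ≢ j → DownClosed i A → removeAt x i ≡ removeAt y i →
               ∣ lookup y i ∣ ≤ ∣ lookup x i ∣ → J j A (removeAt x j) ⊆ J j A (removeAt y j)
  shift-line {i} {j} {A} {x} {y} i≢j closed x~y y≤x t∈ with ∈-J⁻ {j} {A} t∈
  ... | z , z∈A , z~x , refl =
    subst (_∈ J j A (removeAt y j)) (lookup∘update′ (i≢j ∘ sym) z (lookup y i))
          (∈-J⁺ shifted∈A shifted~y)
    where
    shifted : Point (suc n)
    shifted = z [ i ]≔ lookup y i
    shifted∈A : shifted ∈ A
    shifted∈A = closed z∈A (sym (removeAt-[]≔ z i (lookup y i)))
      (subst₂ _≤_ (cong ∣_∣ (sym (lookup∘update i z (lookup y i))))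
                  (cong ∣_∣ (sym (sameLine⇒lookup z x z~x (i≢j ∘ sym)))) y≤x)
    shifted~y : removeAt shifted j ≡ removeAt y j
    shifted~y = lookup⇒sameLine shifted y j agree
      where
      agree : ∀ k → j ≢ k → lookup shifted k ≡ lookup y k
      agree k j≢k with i ≟F k
      ... | yes refl = lookup∘update i z (lookup y i)
      ... | no i≢k = trans (lookup∘update′ (i≢k ∘ sym) z (lookup y i))
                       (trans (sameLine⇒lookup z x z~x j≢k) (sameLine⇒lookup x y x~y i≢k))

  -- For i ≢ j, C_j preserves i-down-closedness: the j-line of y carries at
  -- least as many points of A as that of x, and y_j = x_j.
  C-preserves-downClosed : ∀ {i j A} → i ≢ j → DownClosed i A → DownClosed i (C j A)
  C-preserves-downClosed {i} {j} {A} i≢j closed {x} {y} x∈C x~y y≤x with ∈-C⁻ {j} {A} x∈C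
  ... | (t , t∈) , bound =
    ∈-C⁺ {j} {A} (lines t∈)
         (subst (λ v → ∣ v ∣ ≤ ℓ j A (removeAt y j) / 2) (sameLine⇒lookup x y x~y i≢j)
                (ℕP.≤-trans bound (/-monoˡ-≤ 2 (#distinct-mono lines))))
    where
    lines : J j A (removeAt x j) ⊆ J j A (removeAt y j)
    lines = shift-line {x = x} {y = y} i≢j closed x~y y≤x

lemma4p1 : (n : ℕ) (A : FinSet (suc n)) (i j : Fin (suc n)) →
    Compressed i A → Compressed i (C j A)
lemma4p1 n A i j compressed with i ≟F j
... | yes refl = downClosed⇒compressed (C-downClosed {A = A})
... | no i≢j  = downClosed⇒compressed
                  (C-preserves-downClosed i≢j (compressed⇒downClosed compressed))
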